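{- Let $N$ be a matroid with at least two elements that has the transitivity property. Let $N'$ be obtained from $N$ by adding a new element $f$ in parallel to a non-loop element $e$ of $N$. Then there is an element $g \in E(N')$ such that $N' \backslash g$ is isomorphic to $N$ and has $\{e,f\}$ as a 2-circuit. Moreover, $g$ is in a 2-circuit of $N$.
   Context: An $N$-minor is a minor isomorphic to $N$; it uses $Z$ if its ground set contains $Z$. A matroid $N$ has the transitivity property if, for every matroid $M$ and every set $\{e,f,g\} \subseteq E(M)$ of three distinct elements, whenever $M$ has an $N$-minor using $\{e,f\}$ and an $N$-minor using $\{f,g\}$, it also has an $N$-minor using $\{e,g\}$. -}

module Defs where

open import Data.Nat using (ℕ; zero; suc; _<_)
open import Data.Fin using (Fin; zero; suc)
open import Data.Fin.Subset using (Subset; _∈_; _∉_; _⊆_; ⊥; ⁅_⁆; _∪_; _∩_; ∣_∣; inside; outside)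
open import Data.Vec using (Vec; []; _∷_)
open import Data.Product using (Σ; ∃; _×_; _,_)
open import Function using (_∘_)
open import Function.Definitions using (Injective)
open import Relation.Binary.PropositionalEquality using (_≡_; _≢_)
open import Relation.Nullary using (¬_)

_⇔_ : Set → Set → Set
A ⇔ B = (A → B) × (B → A)

record Matroid (n : ℕ) : Set₁ where
  field
    Indep     : Subset n → Set
    indep-∅   : Indep ⊥
    indep-⊆   : ∀ X Y → X ⊆ Y → Indep Y → Indep X
    indep-aug : ∀ X Y → Indep X → Indep Y → ∣ X ∣ < ∣ Y ∣ →
                ∃ λ x → x ∈ Y × x ∉ X × Indep (X ∪ ⁅ x ⁆)
open Matroid public

image : ∀ {k m} → (Fin k → Fin m) → Subset k → Subset m
image {zero}  φ []           = ⊥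
image {suc k} φ (inside ∷ Y)  = ⁅ φ zero ⁆ ∪ image (φ ∘ suc) Y
image {suc k} φ (outside ∷ Y) = image (φ ∘ suc) Y

IsBasisOf : ∀ {m} → (Subset m → Set) → Subset m → Subset m → Set
IsBasisOf Ind C B = B ⊆ C × Ind B × (∀ x → x ∈ C → x ∉ B → ¬ Ind (B ∪ ⁅ x ⁆))

-- Independence in the contraction M / C (for sets disjoint from C):
-- X is independent iff X ∪ B is independent for a basis B of C.
ContrIndep : ∀ {m} → (Subset m → Set) → Subset m → Subset m → Set
ContrIndep Ind C X = ∃ λ B → IsBasisOf Ind C B × Ind (X ∪ B)

-- The minor M / C \ D (C, D disjoint) is isomorphic to the matroid whose
-- independence predicate is IndN (on ground set Fin k): φ is a bijection
-- from Fin k onto E(M) - (C ∪ D) mapping independent sets exactly to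
-- independent sets of M / C \ D.
MinorIso : ∀ {k m} → (Subset k → Set) → (Subset m → Set) → Subset m → Subset m → Set
MinorIso {k} {m} IndN IndM C D =
  (C ∩ D ≡ ⊥) ×
  Σ (Fin k → Fin m) λ φ →
    Injective _≡_ _≡_ φ ×
    (∀ y → φ y ∉ C × φ y ∉ D) ×
    (∀ x → x ∉ C → x ∉ D → ∃ λ y → φ y ≡ x) ×
    (∀ Y → IndN Y ⇔ ContrIndep IndM C (image φ Y))

HasMinorUsing : ∀ {k m} → Matroid k → Matroid m → Fin m → Fin m → Set
HasMinorUsing N M e f =
  ∃ λ C → ∃ λ D → MinorIso (Indep N) (Indep M) C D ×
    e ∉ C × e ∉ D × f ∉ C × f ∉ D

HasTransitivity : ∀ {k} → Matroid k → Set₁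
HasTransitivity N =
  ∀ m (M : Matroid m) (e f g : Fin m) → e ≢ f → f ≢ g → e ≢ g →
  HasMinorUsing N M e f → HasMinorUsing N M f g → HasMinorUsing N M e g

IsCircuit : ∀ {m} → (Subset m → Set) → Subset m → Set
IsCircuit Ind X = ¬ Ind X × (∀ x → x ∈ X → ∀ Y → Y ⊆ X → x ∉ Y → Ind Y)

-- Parallel extension: N' has ground set Fin (suc k); the new element f is
-- 'zero', and the element i of N is 'suc i'. f is added in parallel to e:
-- X is independent in N' iff it does not contain both e and f, and
-- replacing f by e gives an independent set of N.
ParallelIndep : ∀ {k} → Matroid k → Fin k → Subset (suc k) → Set
ParallelIndep N e (outside ∷ Y) = Indep N Y
ParallelIndep N e (inside ∷ Y)  = e ∉ Y × Indep N (Y ∪ ⁅ e ⁆)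

-- N′ has an N-minor using {e, c} (delete f) and one using {c, f} (delete e,
-- letting f play the role of e), so by transitivity an N-minor using {e, f}.
-- As N′ has one element more than N and the same rank, this minor removes a
-- single element g, and g can only have been contracted if it is a loop; so
-- N′ \ g ≅ N. Transporting the 2-circuit {f, e} of N′ along N′ \ g ≅ N = N′ \ f
-- walks along the orbit of f; the orbit must reach g, and the 2-circuit
-- transported just before that contains g.
module Submission where

open import Defs
open import Data.Nat using (ℕ; zero; suc; _≤_; _<_; s≤s)
open import Data.Nat.Properties using (≤-trans; ≤-pred; ≰⇒>; n<1+n; <-irrefl)
open import Data.Nat.GeneralisedArithmetic using (fold; iterate; iterate-is-fold)
open import Data.Fin using (Fin; zero; suc; toℕ; punchOut; _≟_)
open import Data.Fin.Properties using (suc-injective; punchOut-injective; any?; pigeonhole; <⇒notInjective)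
open import Data.Fin.Subset using (Subset; Empty; _∈_; _∉_; _⊆_; ⊥; ⁅_⁆; _∪_; ∣_∣; inside; outside)
open import Data.Fin.Subset.Properties
  using (_∈?_; x∈⁅x⁆; x∈⁅y⁆⇒x≡y; x≢y⇒x∉⁅y⁆; x∉⁅y⁆⇒x≢y; ∉⊥; ⊥⊆; Empty-unique; drop-there; drop-∷-⊆;
         ⊆-antisym; p⊆p∪q; q⊆p∪q; x∈p∪q⁻; x∈p∪q⁺; ∪-identityˡ; ∪-identityʳ; ∪-comm; ∪-assoc; ∪-idem;
         ∩-zeroˡ; ∣⊥∣≡0; ∣p∣≤n)
open import Data.Vec using ([]; _∷_; here; there)
open import Data.Product using (Σ; ∃; _×_; _,_; proj₁; proj₂; swap)
open import Data.Sum using (_⊎_; inj₁; inj₂; [_,_]′)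
open import Data.Empty using (⊥-elim)
open import Function using (_∘_; id)
open import Function.Definitions using (Injective)
open import Relation.Nullary using (¬_; Dec; yes; no)
open import Relation.Nullary.Decidable using (¬¬-excluded-middle; _⊎-dec_)
open import Relation.Unary using (Decidable)
open import Relation.Binary.PropositionalEquality using (_≡_; _≢_; refl; sym; trans; cong; cong₂; subst; subst₂)

⇔-trans : ∀ {A B C : Set} → A ⇔ B → B ⇔ C → A ⇔ C
⇔-trans (f , f⁻) (g , g⁻) = g ∘ f , f⁻ ∘ g⁻

x∉p⇒∣p∪⁅x⁆∣≡1+∣p∣ : ∀ {n} (p : Subset n) (x : Fin n) → x ∉ p → ∣ p ∪ ⁅ x ⁆ ∣ ≡ suc ∣ p ∣
x∉p⇒∣p∪⁅x⁆∣≡1+∣p∣ (inside ∷ p)  zero    x∉p = ⊥-elim (x∉p here)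
x∉p⇒∣p∪⁅x⁆∣≡1+∣p∣ (outside ∷ p) zero    x∉p = cong (suc ∘ ∣_∣) (∪-identityʳ p)
x∉p⇒∣p∪⁅x⁆∣≡1+∣p∣ (inside ∷ p)  (suc x) x∉p = cong suc (x∉p⇒∣p∪⁅x⁆∣≡1+∣p∣ p x (x∉p ∘ there))
x∉p⇒∣p∪⁅x⁆∣≡1+∣p∣ (outside ∷ p) (suc x) x∉p = x∉p⇒∣p∪⁅x⁆∣≡1+∣p∣ p x (x∉p ∘ there)

∪-monoˡ-⊆ : ∀ {n} {p q : Subset n} (r : Subset n) → p ⊆ q → p ∪ r ⊆ q ∪ r
∪-monoˡ-⊆ {p = p} {q} r p⊆q x∈p∪r with x∈p∪q⁻ p r x∈p∪r
... | inj₁ x∈p = p⊆p∪q r (p⊆q x∈p)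
... | inj₂ x∈r = q⊆p∪q q r x∈r

∪-monoʳ-⊆ : ∀ {n} (p : Subset n) {q r : Subset n} → q ⊆ r → p ∪ q ⊆ p ∪ r
∪-monoʳ-⊆ p {q} {r} q⊆r = subst₂ _⊆_ (∪-comm q p) (∪-comm r p) (∪-monoˡ-⊆ p q⊆r)

∪-swapʳ : ∀ {n} (p q r : Subset n) → (p ∪ q) ∪ r ≡ (p ∪ r) ∪ q
∪-swapʳ p q r = trans (∪-assoc p q r) (trans (cong (p ∪_) (∪-comm q r)) (sym (∪-assoc p r q)))

x∈p⇒⁅x⁆⊆p : ∀ {n} {p : Subset n} {x} → x ∈ p → ⁅ x ⁆ ⊆ p
x∈p⇒⁅x⁆⊆p {p = p} x∈p y∈⁅x⁆ = subst (_∈ p) (sym (x∈⁅y⁆⇒x≡y _ y∈⁅x⁆)) x∈p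

≢⇒∉⁅⁆∪⁅⁆ : ∀ {n} {x a b : Fin n} → x ≢ a → x ≢ b → x ∉ ⁅ a ⁆ ∪ ⁅ b ⁆
≢⇒∉⁅⁆∪⁅⁆ x≢a x≢b = [ x≢y⇒x∉⁅y⁆ x≢a , x≢y⇒x∉⁅y⁆ x≢b ]′ ∘ x∈p∪q⁻ _ _

∈⊎∈⇒≢ : ∀ {n} {C D : Subset n} {x y} → y ∈ C ⊎ y ∈ D → x ∉ C → x ∉ D → y ≢ x
∈⊎∈⇒≢ (inj₁ y∈C) x∉C _   refl = x∉C y∈C
∈⊎∈⇒≢ (inj₂ y∈D) _   x∉D refl = x∉D y∈D

∈-image⁻ : ∀ {k m} (φ : Fin k → Fin m) Y x → x ∈ image φ Y → ∃ λ y → y ∈ Y × φ y ≡ x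
∈-image⁻ {zero}  φ []           x x∈ = ⊥-elim (∉⊥ x∈)
∈-image⁻ {suc k} φ (inside ∷ Y) x x∈ with x∈p∪q⁻ ⁅ φ zero ⁆ (image (φ ∘ suc) Y) x∈
... | inj₁ x∈⁅φ0⁆ = zero , here , sym (x∈⁅y⁆⇒x≡y _ x∈⁅φ0⁆)
... | inj₂ x∈rest with ∈-image⁻ (φ ∘ suc) Y x x∈rest
...   | y , y∈Y , φy≡x = suc y , there y∈Y , φy≡x
∈-image⁻ {suc k} φ (outside ∷ Y) x x∈ with ∈-image⁻ (φ ∘ suc) Y x x∈
... | y , y∈Y , φy≡x = suc y , there y∈Y , φy≡x

∈-image⁺ : ∀ {k m} (φ : Fin k → Fin m) {Y y} → y ∈ Y → φ y ∈ image φ Y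
∈-image⁺ φ {inside ∷ Y}  {zero}  here       = p⊆p∪q _ (x∈⁅x⁆ (φ zero))
∈-image⁺ φ {inside ∷ Y}  {suc y} (there y∈) = q⊆p∪q _ _ (∈-image⁺ (φ ∘ suc) y∈)
∈-image⁺ φ {outside ∷ Y} {suc y} (there y∈) = ∈-image⁺ (φ ∘ suc) y∈

∣image∣≡∣p∣ : ∀ {k m} (φ : Fin k → Fin m) → Injective _≡_ _≡_ φ → ∀ Y → ∣ image φ Y ∣ ≡ ∣ Y ∣
∣image∣≡∣p∣ {m = m} φ inj []  = ∣⊥∣≡0 m
∣image∣≡∣p∣ φ inj (outside ∷ Y) = ∣image∣≡∣p∣ (φ ∘ suc) (suc-injective ∘ inj) Y
∣image∣≡∣p∣ φ inj (inside ∷ Y)  = begin-size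
  where
  φ0∉rest : φ zero ∉ image (φ ∘ suc) Y
  φ0∉rest φ0∈ with ∈-image⁻ (φ ∘ suc) Y (φ zero) φ0∈
  ... | _ , _ , φsy≡φ0 with inj φsy≡φ0
  ... | ()
  begin-size : ∣ ⁅ φ zero ⁆ ∪ image (φ ∘ suc) Y ∣ ≡ suc ∣ Y ∣
  begin-size = trans (cong ∣_∣ (∪-comm ⁅ φ zero ⁆ _))
    (trans (x∉p⇒∣p∪⁅x⁆∣≡1+∣p∣ _ (φ zero) φ0∉rest)
           (cong suc (∣image∣≡∣p∣ (φ ∘ suc) (suc-injective ∘ inj) Y)))

image-⁅⁆ : ∀ {k m} (φ : Fin k → Fin m) y → image φ ⁅ y ⁆ ≡ ⁅ φ y ⁆
image-⁅⁆ φ y = ⊆-antisym ⊆⁅φy⁆ (λ x∈ → subst (_∈ image φ ⁅ y ⁆) (sym (x∈⁅y⁆⇒x≡y _ x∈)) (∈-image⁺ φ (x∈⁅x⁆ y)))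
  where
  ⊆⁅φy⁆ : image φ ⁅ y ⁆ ⊆ ⁅ φ y ⁆
  ⊆⁅φy⁆ {x} x∈ with ∈-image⁻ φ ⁅ y ⁆ x x∈
  ... | z , z∈⁅y⁆ , refl = subst (λ t → φ t ∈ ⁅ φ y ⁆) (sym (x∈⁅y⁆⇒x≡y y z∈⁅y⁆)) (x∈⁅x⁆ (φ y))

image-∪ : ∀ {k m} (φ : Fin k → Fin m) Y Z → image φ (Y ∪ Z) ≡ image φ Y ∪ image φ Z
image-∪ φ Y Z = ⊆-antisym ⊆∪ (λ x∈ → [ mono (p⊆p∪q Z) , mono (q⊆p∪q Y Z) ]′ (x∈p∪q⁻ _ _ x∈))
  where
  mono : ∀ {Y′ Z′} → Y′ ⊆ Z′ → image φ Y′ ⊆ image φ Z′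
  mono {Y′} Y′⊆Z′ {x} x∈ with ∈-image⁻ φ Y′ x x∈
  ... | y , y∈ , refl = ∈-image⁺ φ (Y′⊆Z′ y∈)
  ⊆∪ : image φ (Y ∪ Z) ⊆ image φ Y ∪ image φ Z
  ⊆∪ {x} x∈ with ∈-image⁻ φ (Y ∪ Z) x x∈
  ... | y , y∈ , refl = x∈p∪q⁺ ([ inj₁ ∘ ∈-image⁺ φ , inj₂ ∘ ∈-image⁺ φ ]′ (x∈p∪q⁻ Y Z y∈))

image-suc : ∀ {k} (Y : Subset k) → image suc Y ≡ outside ∷ Y
image-suc Y = ⊆-antisym ⊆out (λ { {suc y} (there y∈) → ∈-image⁺ suc y∈ })
  where
  ⊆out : image suc Y ⊆ outside ∷ Y
  ⊆out {x} x∈ with ∈-image⁻ suc Y x x∈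
  ... | y , y∈ , refl = there y∈

RestrictionIso : ∀ {k m} → (Subset k → Set) → (Subset m → Set) → (Fin k → Fin m) → Set
RestrictionIso IndN IndM φ = ∀ Y → IndN Y ⇔ IndM (image φ Y)

record Parallel {m} (Ind : Subset m → Set) (a b : Fin m) : Set where
  constructor parallel
  field
    indep-a : Ind ⁅ a ⁆
    indep-b : Ind ⁅ b ⁆
    dependent : ¬ Ind (⁅ a ⁆ ∪ ⁅ b ⁆)

Parallel-sym : ∀ {m} {Ind : Subset m → Set} {a b} → Parallel Ind a b → Parallel Ind b a
Parallel-sym {Ind = Ind} {a} {b} (parallel ia ib dep) = parallel ib ia (dep ∘ subst Ind (∪-comm ⁅ b ⁆ ⁅ a ⁆))

Parallel⇒≢ : ∀ {m} {Ind : Subset m → Set} {a b} → Parallel Ind a b → a ≢ b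
Parallel⇒≢ {Ind = Ind} {a} (parallel ia _ dep) refl = dep (subst Ind (sym (∪-idem ⁅ a ⁆)) ia)

⊆⁅a⁆∪⁅b⁆⇒⊆⁅b⁆ : ∀ {m} {Y : Subset m} {a b} → Y ⊆ ⁅ a ⁆ ∪ ⁅ b ⁆ → a ∉ Y → Y ⊆ ⁅ b ⁆
⊆⁅a⁆∪⁅b⁆⇒⊆⁅b⁆ {Y = Y} {a} {b} Y⊆ab a∉Y {z} z∈Y with x∈p∪q⁻ ⁅ a ⁆ ⁅ b ⁆ (Y⊆ab z∈Y)
... | inj₁ z∈⁅a⁆ = ⊥-elim (a∉Y (subst (_∈ Y) (x∈⁅y⁆⇒x≡y a z∈⁅a⁆) z∈Y))
... | inj₂ z∈⁅b⁆ = z∈⁅b⁆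

Parallel⇒IsCircuit : ∀ {m} (M : Matroid m) {a b} → Parallel (Indep M) a b → IsCircuit (Indep M) (⁅ a ⁆ ∪ ⁅ b ⁆)
Parallel⇒IsCircuit M {a} {b} (parallel ia ib dep) = dep , proper-subsets-independent
  where
  proper-subsets-independent : ∀ x → x ∈ ⁅ a ⁆ ∪ ⁅ b ⁆ → ∀ Y → Y ⊆ ⁅ a ⁆ ∪ ⁅ b ⁆ → x ∉ Y → Indep M Y
  proper-subsets-independent x x∈ab Y Y⊆ab x∉Y with x∈p∪q⁻ ⁅ a ⁆ ⁅ b ⁆ x∈ab
  ... | inj₁ x∈⁅a⁆ = indep-⊆ M Y ⁅ b ⁆ (⊆⁅a⁆∪⁅b⁆⇒⊆⁅b⁆ Y⊆ab (subst (_∉ Y) (x∈⁅y⁆⇒x≡y a x∈⁅a⁆) x∉Y)) ib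
  ... | inj₂ x∈⁅b⁆ = indep-⊆ M Y ⁅ a ⁆
          (⊆⁅a⁆∪⁅b⁆⇒⊆⁅b⁆ (subst (Y ⊆_) (∪-comm ⁅ a ⁆ ⁅ b ⁆) Y⊆ab) (subst (_∉ Y) (x∈⁅y⁆⇒x≡y b x∈⁅b⁆) x∉Y)) ia

Parallel-image : ∀ {k m} {IndN : Subset k → Set} {IndM : Subset m → Set} (φ : Fin k → Fin m) →
                 RestrictionIso IndN IndM φ → ∀ a b → Parallel IndN a b ⇔ Parallel IndM (φ a) (φ b)
Parallel-image {IndN = IndN} {IndM} φ iso a b = to , from
  where
  single : ∀ x → IndN ⁅ x ⁆ ⇔ IndM ⁅ φ x ⁆
  single x = subst (λ S → IndN ⁅ x ⁆ ⇔ IndM S) (image-⁅⁆ φ x) (iso ⁅ x ⁆)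
  pair : IndN (⁅ a ⁆ ∪ ⁅ b ⁆) ⇔ IndM (⁅ φ a ⁆ ∪ ⁅ φ b ⁆)
  pair = subst (λ S → IndN (⁅ a ⁆ ∪ ⁅ b ⁆) ⇔ IndM S)
           (trans (image-∪ φ ⁅ a ⁆ ⁅ b ⁆) (cong₂ _∪_ (image-⁅⁆ φ a) (image-⁅⁆ φ b))) (iso _)
  to : Parallel IndN a b → Parallel IndM (φ a) (φ b)
  to (parallel ia ib dep) = parallel (proj₁ (single a) ia) (proj₁ (single b) ib) (dep ∘ proj₂ pair)
  from : Parallel IndM (φ a) (φ b) → Parallel IndN a b
  from (parallel ia ib dep) = parallel (proj₂ (single a) ia) (proj₂ (single b) ib) (dep ∘ proj₁ pair)

InTwoCircuit : ∀ {k} → Matroid k → Fin k → Set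
InTwoCircuit N x = ∃ λ h → h ≢ x × IsCircuit (Indep N) (⁅ x ⁆ ∪ ⁅ h ⁆)

Parallel⇒InTwoCircuit : ∀ {k} (N : Matroid k) {x h} → Parallel (Indep N) x h → InTwoCircuit N x
Parallel⇒InTwoCircuit N {x} {h} x∥h = h , Parallel⇒≢ (Parallel-sym x∥h) , Parallel⇒IsCircuit N x∥h

-- Minors with contracted loops

ContrIndep-loops : ∀ {m} (M : Matroid m) {C} → (∀ x → x ∈ C → ¬ Indep M ⁅ x ⁆) →
                   ∀ X → ContrIndep (Indep M) C X ⇔ Indep M X
ContrIndep-loops M {C} loops X = forget , (λ iX → ⊥ , ⊥-basis , subst (Indep M) (sym (∪-identityʳ X)) iX)
  where
  forget : ContrIndep (Indep M) C X → Indep M X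
  forget (B , _ , iX∪B) = indep-⊆ M X (X ∪ B) (p⊆p∪q B) iX∪B
  ⊥-basis : IsBasisOf (Indep M) C ⊥
  ⊥-basis = ⊥⊆ , indep-∅ M , λ x x∈C _ → loops x x∈C ∘ subst (Indep M) (∪-identityˡ ⁅ x ⁆)

no-loops-in-⊥ : ∀ {m} (M : Matroid m) → ∀ x → x ∈ ⊥ → ¬ Indep M ⁅ x ⁆
no-loops-in-⊥ M x x∈⊥ = ⊥-elim (∉⊥ x∈⊥)

restrictionIso⇒minorIso : ∀ {k m} {IndN : Subset k → Set} (M : Matroid m) {D} (φ : Fin k → Fin m) →
  Injective _≡_ _≡_ φ → (∀ y → φ y ∉ D) → (∀ x → x ∉ D → ∃ λ y → φ y ≡ x) →
  RestrictionIso IndN (Indep M) φ → MinorIso IndN (Indep M) ⊥ D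
restrictionIso⇒minorIso M {D} φ inj φ∉D onto iso =
  ∩-zeroˡ D , φ , inj , (λ y → ∉⊥ , φ∉D y) , (λ x _ → onto x) ,
  λ Y → ⇔-trans (iso Y) (swap (ContrIndep-loops M (no-loops-in-⊥ M) (image φ Y)))

injection-misses-at-most-one : ∀ {k} (φ : Fin k → Fin (suc k)) → Injective _≡_ _≡_ φ →
  ∀ {x g} → (∀ y → φ y ≢ x) → (∀ y → φ y ≢ g) → x ≡ g
injection-misses-at-most-one {zero}  φ _   {zero} {zero} _ _ = refl
injection-misses-at-most-one {suc k} φ inj {x} {g} φ≢x φ≢g with x ≟ g
... | yes x≡g = x≡g
... | no x≢g  = ⊥-elim (<⇒notInjective (n<1+n k) χ-injective)
  where
  g≢φ : ∀ y → g ≢ φ y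
  g≢φ y = φ≢g y ∘ sym
  x′≢ : ∀ y → punchOut (x≢g ∘ sym) ≢ punchOut (g≢φ y)
  x′≢ y = φ≢x y ∘ sym ∘ punchOut-injective (x≢g ∘ sym) (g≢φ y)
  χ : Fin (suc k) → Fin k
  χ y = punchOut (x′≢ y)
  χ-injective : Injective _≡_ _≡_ χ
  χ-injective eq = inj (punchOut-injective (g≢φ _) (g≢φ _) (punchOut-injective (x′≢ _) (x′≢ _) eq))

injection-misses-some : ∀ {k} (φ : Fin k → Fin (suc k)) {P : Fin (suc k) → Set} → Decidable P →
  (∀ x → ¬ P x → ∃ λ y → φ y ≡ x) → ∃ P
injection-misses-some {k} φ {P} P? onto with any? P?
... | yes ∃P = ∃P
... | no ∄P = ⊥-elim (<⇒notInjective (n<1+n k) ψ-injective)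
  where
  ψ : Fin (suc k) → Fin k
  ψ x = proj₁ (onto x (∄P ∘ (x ,_)))
  ψ-injective : Injective _≡_ _≡_ ψ
  ψ-injective {a} {b} eq =
    trans (sym (proj₂ (onto a (∄P ∘ (a ,_))))) (trans (cong φ eq) (proj₂ (onto b (∄P ∘ (b ,_)))))

¬¬-maximum-independent : ∀ {k} (N : Matroid k) →
  ¬ ¬ (∃ λ B → Indep N B × ∀ I → Indep N I → ∣ I ∣ ≤ ∣ B ∣)
¬¬-maximum-independent {k} N = below k (λ I _ → ∣p∣≤n I)
  where
  below : ∀ m → (∀ I → Indep N I → ∣ I ∣ ≤ m) → ¬ ¬ (∃ λ B → Indep N B × ∀ I → Indep N I → ∣ I ∣ ≤ ∣ B ∣)
  below zero    bound none = none (⊥ , indep-∅ N , λ I iI → subst (∣ I ∣ ≤_) (sym (∣⊥∣≡0 k)) (bound I iI))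
  below (suc m) bound none = ¬¬-excluded-middle {A = ∃ λ B → Indep N B × suc m ≤ ∣ B ∣} λ where
    (yes (B , iB , m<∣B∣)) → none (B , iB , λ I iI → ≤-trans (bound I iI) m<∣B∣)
    (no ∄B) → below m (λ I iI → ≤-pred (≰⇒> (λ m<∣I∣ → ∄B (I , iI , m<∣I∣)))) none

-- A non-loop in the contracted set would enlarge the image of a maximum
-- independent set of N beyond the rank of N.
contracted-elements-are-loops : ∀ {k m} (N : Matroid k) (M : Matroid m) {C D} →
  (∀ Y → Indep M Y → ∃ λ X → Indep N X × ∣ X ∣ ≡ ∣ Y ∣) →
  MinorIso (Indep N) (Indep M) C D → ∀ x → x ∈ C → ¬ Indep M ⁅ x ⁆
contracted-elements-are-loops N M {C} rank≤ (_ , φ , inj , avoid , _ , iso) x x∈C ix =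
  ¬¬-maximum-independent N λ (B , iB , maximum) →
    let B′ , (B′⊆C , _ , maximal) , iφB∪B′ = proj₁ (iso B) iB
        B′-empty : Empty B′
        B′-empty (z , z∈B′) = too-large B maximum z (B′⊆C z∈B′)
          (indep-⊆ M _ _ (∪-monoʳ-⊆ (image φ B) (x∈p⇒⁅x⁆⊆p z∈B′)) iφB∪B′)
    in maximal x x∈C (λ x∈B′ → B′-empty (x , x∈B′))
         (subst (Indep M) (sym (trans (cong (_∪ ⁅ x ⁆) (Empty-unique B′-empty)) (∪-identityˡ ⁅ x ⁆))) ix)
  where
  too-large : ∀ B → (∀ I → Indep N I → ∣ I ∣ ≤ ∣ B ∣) → ∀ z → z ∈ C → ¬ Indep M (image φ B ∪ ⁅ z ⁆)
  too-large B maximum z z∈C i with rank≤ _ i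
  ... | X , iX , ∣X∣≡ = <-irrefl refl (subst (_≤ ∣ B ∣) (trans ∣X∣≡ size) (maximum X iX))
    where
    z∉φB : z ∉ image φ B
    z∉φB z∈ with ∈-image⁻ φ B z z∈
    ... | y , _ , refl = proj₁ (avoid y) z∈C
    size : ∣ image φ B ∪ ⁅ z ⁆ ∣ ≡ suc ∣ B ∣
    size = trans (x∉p⇒∣p∪⁅x⁆∣≡1+∣p∣ _ z z∉φB) (cong suc (∣image∣≡∣p∣ φ inj B))

one-point-extension-minor : ∀ {k} (N : Matroid k) (M : Matroid (suc k)) {C D} →
  (∀ Y → Indep M Y → ∃ λ X → Indep N X × ∣ X ∣ ≡ ∣ Y ∣) →
  MinorIso (Indep N) (Indep M) C D →
  ∃ λ g → (g ∈ C ⊎ g ∈ D) × MinorIso (Indep N) (Indep M) ⊥ ⁅ g ⁆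
one-point-extension-minor {k} N M {C} {D} rank≤ minor@(_ , φ , inj , avoid , onto , iso) =
  g , g-removed , restrictionIso⇒minorIso M φ inj φ∉⁅g⁆ onto-rest restriction
  where
  Removed : Fin (suc k) → Set
  Removed x = x ∈ C ⊎ x ∈ D
  φ-kept : ∀ y → ¬ Removed (φ y)
  φ-kept y = [ proj₁ (avoid y) , proj₂ (avoid y) ]′
  g,g-removed : ∃ Removed
  g,g-removed = injection-misses-some φ (λ x → (x ∈? C) ⊎-dec (x ∈? D))
                  (λ x kept → onto x (kept ∘ inj₁) (kept ∘ inj₂))
  g : Fin (suc k)
  g = proj₁ g,g-removed
  g-removed : Removed g
  g-removed = proj₂ g,g-removed
  φ∉⁅g⁆ : ∀ y → φ y ∉ ⁅ g ⁆
  φ∉⁅g⁆ y = x≢y⇒x∉⁅y⁆ λ φy≡g → φ-kept y (subst Removed (sym φy≡g) g-removed)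
  only-g-removed : ∀ x → Removed x → x ≡ g
  only-g-removed x x-removed = injection-misses-at-most-one φ inj
    (λ y φy≡x → φ-kept y (subst Removed (sym φy≡x) x-removed)) (x∉⁅y⁆⇒x≢y ∘ φ∉⁅g⁆)
  onto-rest : ∀ x → x ∉ ⁅ g ⁆ → ∃ λ y → φ y ≡ x
  onto-rest x x∉⁅g⁆ = onto x (x∉⁅y⁆⇒x≢y x∉⁅g⁆ ∘ only-g-removed x ∘ inj₁)
                             (x∉⁅y⁆⇒x≢y x∉⁅g⁆ ∘ only-g-removed x ∘ inj₂)
  restriction : RestrictionIso (Indep N) (Indep M) φ
  restriction Y =
    ⇔-trans (iso Y) (ContrIndep-loops M (contracted-elements-are-loops N M rank≤ minor) (image φ Y))

-- The orbit of f

module ParallelOrbit {k} (N : Matroid k) (M : Matroid (suc k))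
  (M∖f≅N : RestrictionIso (Indep N) (Indep M) suc)
  {g : Fin (suc k)} (g≢f : g ≢ zero) (φ : Fin k → Fin (suc k))
  (φ≢g : ∀ y → φ y ≢ g) (onto : ∀ x → x ≢ g → ∃ λ y → φ y ≡ x)
  (M∖g≅N : RestrictionIso (Indep N) (Indep M) φ) where

  -- φ⁻¹ followed by suc; the value at g only has to avoid f.
  step : Fin (suc k) → Fin (suc k)
  step x with x ≟ g
  ... | yes _   = g
  ... | no x≢g = suc (proj₁ (onto x x≢g))

  step-off-g : ∀ x → x ≢ g → ∃ λ y → φ y ≡ x × step x ≡ suc y
  step-off-g x x≢g with x ≟ g
  ... | yes x≡g  = ⊥-elim (x≢g x≡g)
  ... | no x≢g′ = proj₁ (onto x x≢g′) , proj₂ (onto x x≢g′) , refl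

  step≢f : ∀ x → step x ≢ zero
  step≢f x with x ≟ g
  ... | yes _ = g≢f
  ... | no _  = λ ()

  step-injective-off-g : ∀ {a b} → a ≢ g → b ≢ g → step a ≡ step b → a ≡ b
  step-injective-off-g {a} {b} a≢g b≢g eq with step-off-g a a≢g | step-off-g b b≢g
  ... | y , refl , step-a | v , refl , step-b = cong φ (suc-injective (trans (sym step-a) (trans eq step-b)))

  orbit : ℕ → Fin (suc k)
  orbit = fold zero step

  collision⇒reaches-g : ∀ i j → i < j → orbit i ≡ orbit j → ∃ λ n → orbit n ≡ g
  collision⇒reaches-g zero    (suc j) _         eq = ⊥-elim (step≢f (orbit j) (sym eq))
  collision⇒reaches-g (suc i) (suc j) (s≤s i<j) eq = earlier-hit (orbit i ≟ g) (orbit j ≟ g)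
    where
    earlier-hit : Dec (orbit i ≡ g) → Dec (orbit j ≡ g) → ∃ λ n → orbit n ≡ g
    earlier-hit (yes hit) _         = i , hit
    earlier-hit (no _)    (yes hit) = j , hit
    earlier-hit (no i≢g)  (no j≢g)  = collision⇒reaches-g i j i<j (step-injective-off-g i≢g j≢g eq)

  orbit-reaches-g : ∃ λ n → orbit n ≡ g
  orbit-reaches-g =
    let i , j , i<j , eq = pigeonhole (n<1+n (suc k)) (orbit ∘ toℕ)
    in collision⇒reaches-g (toℕ i) (toℕ j) i<j eq

  GInTwoCircuit : Set
  GInTwoCircuit = ∃ λ g′ → g ≡ suc g′ × InTwoCircuit N g′

  -- A parallel pair {a, b} avoiding g is sent by φ⁻¹ to a parallel pair of N,
  -- hence by suc to the parallel pair {step a, step b} of M.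
  walk : ∀ n {a b} → Parallel (Indep M) a b → a ≢ g → b ≢ g → iterate step a (suc n) ≡ g → GInTwoCircuit
  walk n {a} {b} a∥b a≢g b≢g hits with step-off-g a a≢g | step-off-g b b≢g
  ... | y , refl , step-a | v , refl , step-b = continue (suc y ≟ g) (suc v ≟ g)
    where
    y∥v : Parallel (Indep N) y v
    y∥v = proj₂ (Parallel-image φ M∖g≅N y v) a∥b
    step-a∥step-b : Parallel (Indep M) (step (φ y)) (step (φ v))
    step-a∥step-b = subst₂ (Parallel (Indep M)) (sym step-a) (sym step-b)
                      (proj₁ (Parallel-image suc M∖f≅N y v) y∥v)
    continue : Dec (suc y ≡ g) → Dec (suc v ≡ g) → GInTwoCircuit
    continue (yes y↦g) _         = y , sym y↦g , Parallel⇒InTwoCircuit N y∥v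
    continue (no _)    (yes v↦g) = v , sym v↦g , Parallel⇒InTwoCircuit N (Parallel-sym y∥v)
    continue (no y↛g)  (no v↛g)  = walk-on n hits
      where
      walk-on : ∀ n → iterate step (step (φ y)) n ≡ g → GInTwoCircuit
      walk-on zero    hit = ⊥-elim (y↛g (trans (sym step-a) hit))
      walk-on (suc n) hit = walk n step-a∥step-b (y↛g ∘ trans (sym step-a)) (v↛g ∘ trans (sym step-b)) hit

  g-in-two-circuit : ∀ {b} → Parallel (Indep M) zero b → b ≢ g → GInTwoCircuit
  g-in-two-circuit f∥b b≢g with orbit-reaches-g
  ... | zero  , f≡g  = ⊥-elim (g≢f (sym f≡g))
  ... | suc n , hits = walk n f∥b (g≢f ∘ sym) b≢g (trans (sym (iterate-is-fold zero step (suc n))) hits)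

deleted-element-in-two-circuit : ∀ {k} (N : Matroid k) (M : Matroid (suc k)) →
  RestrictionIso (Indep N) (Indep M) suc → ∀ {g b} → MinorIso (Indep N) (Indep M) ⊥ ⁅ g ⁆ →
  g ≢ zero → Parallel (Indep M) zero b → b ≢ g → ∃ λ g′ → g ≡ suc g′ × InTwoCircuit N g′
deleted-element-in-two-circuit N M M∖f≅N (_ , φ , _ , avoid , onto , iso) g≢f =
  ParallelOrbit.g-in-two-circuit N M M∖f≅N g≢f φ (λ y → x∉⁅y⁆⇒x≢y (proj₂ (avoid y)))
    (λ x x≢g → onto x ∉⊥ (x≢y⇒x∉⁅y⁆ x≢g))
    (λ Y → ⇔-trans (iso Y) (ContrIndep-loops M (no-loops-in-⊥ M) (image φ Y)))

module ParallelExtension {k} (N : Matroid k) (e : Fin k) where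

  Indep′ : Subset (suc k) → Set
  Indep′ = ParallelIndep N e

  -- The image of a set under the map f ↦ e, i ↦ i.
  merge : Subset (suc k) → Subset k
  merge (outside ∷ Y) = Y
  merge (inside ∷ Y)  = Y ∪ ⁅ e ⁆

  Indep′⇔merge : ∀ Z → suc e ∉ Z → Indep′ Z ⇔ Indep N (merge Z)
  Indep′⇔merge (outside ∷ Z) _   = id , id
  Indep′⇔merge (inside ∷ Z)  e∉Z = proj₂ , (e∉Z ∘ there ,_)

  merge-indep : ∀ Z → Indep′ Z → Indep N (merge Z)
  merge-indep (outside ∷ Z) i       = i
  merge-indep (inside ∷ Z)  (_ , i) = i

  ∣merge∣ : ∀ Z → Indep′ Z → ∣ merge Z ∣ ≡ ∣ Z ∣
  ∣merge∣ (outside ∷ Z) _         = refl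
  ∣merge∣ (inside ∷ Z)  (e∉Z , _) = x∉p⇒∣p∪⁅x⁆∣≡1+∣p∣ Z e e∉Z

  ∈-merge⁻ : ∀ Z {w} → w ∈ merge Z → suc w ∈ Z ⊎ (w ≡ e × zero ∈ Z)
  ∈-merge⁻ (outside ∷ Z) w∈ = inj₁ (there w∈)
  ∈-merge⁻ (inside ∷ Z)  w∈ with x∈p∪q⁻ Z ⁅ e ⁆ w∈
  ... | inj₁ w∈Z   = inj₁ (there w∈Z)
  ... | inj₂ w∈⁅e⁆ = inj₂ (x∈⁅y⁆⇒x≡y e w∈⁅e⁆ , here)

  ∈-merge⁺ : ∀ Z {w} → suc w ∈ Z → w ∈ merge Z
  ∈-merge⁺ (outside ∷ Z) w∈ = drop-there w∈
  ∈-merge⁺ (inside ∷ Z)  w∈ = p⊆p∪q ⁅ e ⁆ (drop-there w∈)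

  e∈merge : ∀ Z → zero ∈ Z → e ∈ merge Z
  e∈merge (inside ∷ Z) _ = q⊆p∪q Z ⁅ e ⁆ (x∈⁅x⁆ e)

  indep′-⊆ : ∀ X Y → X ⊆ Y → Indep′ Y → Indep′ X
  indep′-⊆ (outside ∷ X) (outside ∷ Y) X⊆Y i       = indep-⊆ N X Y (drop-∷-⊆ X⊆Y) i
  indep′-⊆ (outside ∷ X) (inside ∷ Y)  X⊆Y (_ , i) = indep-⊆ N X (Y ∪ ⁅ e ⁆) (p⊆p∪q ⁅ e ⁆ ∘ drop-∷-⊆ X⊆Y) i
  indep′-⊆ (inside ∷ X)  (outside ∷ Y) X⊆Y i with X⊆Y here
  ... | ()
  indep′-⊆ (inside ∷ X)  (inside ∷ Y)  X⊆Y (e∉Y , i) =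
    e∉Y ∘ drop-∷-⊆ X⊆Y , indep-⊆ N _ _ (∪-monoˡ-⊆ ⁅ e ⁆ (drop-∷-⊆ X⊆Y)) i

  insert-old : ∀ X z → z ≢ e → Indep′ X → Indep N (merge X ∪ ⁅ z ⁆) → Indep′ (X ∪ ⁅ suc z ⁆)
  insert-old (outside ∷ X) z z≢e _ i = i
  insert-old (inside ∷ X)  z z≢e (e∉X , _) i =
    [ e∉X , z≢e ∘ sym ∘ x∈⁅y⁆⇒x≡y z ]′ ∘ x∈p∪q⁻ X ⁅ z ⁆ , subst (Indep N) (∪-swapʳ X ⁅ e ⁆ ⁅ z ⁆) i

  insert-e-or-f : ∀ X Y → e ∈ merge Y → e ∉ merge X → Indep N (merge X ∪ ⁅ e ⁆) →
                  ∃ λ x → x ∈ Y × x ∉ X × Indep′ (X ∪ ⁅ x ⁆)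
  insert-e-or-f (inside ∷ X)  Y             _   e∉X _ = ⊥-elim (e∉X (q⊆p∪q X ⁅ e ⁆ (x∈⁅x⁆ e)))
  insert-e-or-f (outside ∷ X) (inside ∷ Y)  _   e∉X i =
    zero , here , (λ ()) , subst (λ S → e ∉ S × Indep N (S ∪ ⁅ e ⁆)) (sym (∪-identityʳ X)) (e∉X , i)
  insert-e-or-f (outside ∷ X) (outside ∷ Y) e∈Y e∉X i = suc e , there e∈Y , e∉X ∘ drop-there , i

  indep′-aug : ∀ X Y → Indep′ X → Indep′ Y → ∣ X ∣ < ∣ Y ∣ → ∃ λ x → x ∈ Y × x ∉ X × Indep′ (X ∪ ⁅ x ⁆)
  indep′-aug X Y iX iY ∣X∣<∣Y∣
    with indep-aug N (merge X) (merge Y) (merge-indep X iX) (merge-indep Y iY)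
                     (subst₂ _<_ (sym (∣merge∣ X iX)) (sym (∣merge∣ Y iY)) ∣X∣<∣Y∣)
  ... | z , z∈Y , z∉X , i with z ≟ e
  ... | yes refl = insert-e-or-f X Y z∈Y z∉X i
  ... | no z≢e   = suc z , [ id , ⊥-elim ∘ z≢e ∘ proj₁ ]′ (∈-merge⁻ Y z∈Y) , z∉X ∘ ∈-merge⁺ X ,
                   insert-old X z z≢e iX i

  N′ : Matroid (suc k)
  N′ = record { Indep = Indep′ ; indep-∅ = indep-∅ N ; indep-⊆ = indep′-⊆ ; indep-aug = indep′-aug }

  rank-N′≤rank-N : ∀ Y → Indep N′ Y → ∃ λ X → Indep N X × ∣ X ∣ ≡ ∣ Y ∣
  rank-N′≤rank-N Y i = merge Y , merge-indep Y i , ∣merge∣ Y i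

  N′∖f≅N : RestrictionIso (Indep N) (Indep N′) suc
  N′∖f≅N Y = subst (λ S → Indep N Y ⇔ Indep′ S) (sym (image-suc Y)) (id , id)

  minor-using-e-c : ∀ c → HasMinorUsing N N′ (suc e) (suc c)
  minor-using-e-c c =
    ⊥ , ⁅ zero ⁆ , restrictionIso⇒minorIso N′ suc suc-injective (λ _ → ∉⊥ ∘ drop-there) onto N′∖f≅N ,
    ∉⊥ , ∉⊥ ∘ drop-there , ∉⊥ , ∉⊥ ∘ drop-there
    where
    onto : ∀ x → x ∉ ⁅ zero ⁆ → ∃ λ y → suc y ≡ x
    onto zero    x∉ = ⊥-elim (x∉ here)
    onto (suc y) _  = y , refl

  e↦f : Fin k → Fin (suc k)
  e↦f y with y ≟ e
  ... | yes _ = zero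
  ... | no _  = suc y

  e↦f-e : e↦f e ≡ zero
  e↦f-e with e ≟ e
  ... | yes _  = refl
  ... | no e≢e = ⊥-elim (e≢e refl)

  e↦f-≢ : ∀ {y} → y ≢ e → e↦f y ≡ suc y
  e↦f-≢ {y} y≢e with y ≟ e
  ... | yes y≡e = ⊥-elim (y≢e y≡e)
  ... | no _    = refl

  e↦f≡f⇒≡e : ∀ {y} → e↦f y ≡ zero → y ≡ e
  e↦f≡f⇒≡e {y} eq with y ≟ e
  e↦f≡f⇒≡e {y} eq  | yes y≡e = y≡e
  e↦f≡f⇒≡e {y} () | no _

  e↦f≡suc⇒≡ : ∀ {y w} → e↦f y ≡ suc w → y ≡ w
  e↦f≡suc⇒≡ {y} eq with y ≟ e
  e↦f≡suc⇒≡ {y} () | yes _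
  e↦f≡suc⇒≡ {y} eq | no _ = suc-injective eq

  e↦f-injective : Injective _≡_ _≡_ e↦f
  e↦f-injective {a} {b} eq = by-cases (b ≟ e)
    where
    by-cases : Dec (b ≡ e) → a ≡ b
    by-cases (yes b≡e) = trans (e↦f≡f⇒≡e (trans eq (trans (cong e↦f b≡e) e↦f-e))) (sym b≡e)
    by-cases (no b≢e)  = e↦f≡suc⇒≡ (trans eq (e↦f-≢ b≢e))

  e↦f≢e : ∀ y → e↦f y ∉ ⁅ suc e ⁆
  e↦f≢e y with y ≟ e
  ... | yes _   = λ ()
  ... | no y≢e = x≢y⇒x∉⁅y⁆ (y≢e ∘ suc-injective)

  merge-image-e↦f : ∀ Y → merge (image e↦f Y) ≡ Y
  merge-image-e↦f Y = ⊆-antisym ⊆Y ⊇Y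
    where
    ⊆Y : merge (image e↦f Y) ⊆ Y
    ⊆Y {w} w∈ with ∈-merge⁻ (image e↦f Y) w∈
    ... | inj₁ sw∈ with ∈-image⁻ e↦f Y (suc w) sw∈
    ...   | y , y∈Y , eq = subst (_∈ Y) (e↦f≡suc⇒≡ eq) y∈Y
    ⊆Y {w} w∈ | inj₂ (refl , f∈) with ∈-image⁻ e↦f Y zero f∈
    ...   | y , y∈Y , eq = subst (_∈ Y) (e↦f≡f⇒≡e eq) y∈Y
    ⊇Y : Y ⊆ merge (image e↦f Y)
    ⊇Y {w} w∈Y with w ≟ e
    ... | yes refl = e∈merge (image e↦f Y) (subst (_∈ image e↦f Y) e↦f-e (∈-image⁺ e↦f w∈Y))
    ... | no w≢e   = ∈-merge⁺ (image e↦f Y) (subst (_∈ image e↦f Y) (e↦f-≢ w≢e) (∈-image⁺ e↦f w∈Y))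

  N′∖e≅N : RestrictionIso (Indep N) (Indep N′) e↦f
  N′∖e≅N Y = subst (λ S → Indep N S ⇔ Indep′ (image e↦f Y)) (merge-image-e↦f Y)
               (swap (Indep′⇔merge (image e↦f Y) e∉))
    where
    e∉ : suc e ∉ image e↦f Y
    e∉ e∈ with ∈-image⁻ e↦f Y (suc e) e∈
    ... | y , _ , eq = e↦f≢e y (subst (_∈ ⁅ suc e ⁆) (sym eq) (x∈⁅x⁆ (suc e)))

  minor-using-c-f : ∀ {c} → c ≢ e → HasMinorUsing N N′ (suc c) zero
  minor-using-c-f {c} c≢e =
    ⊥ , ⁅ suc e ⁆ , restrictionIso⇒minorIso N′ e↦f e↦f-injective e↦f≢e onto N′∖e≅N ,
    ∉⊥ , x≢y⇒x∉⁅y⁆ (c≢e ∘ suc-injective) , ∉⊥ , (λ ())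
    where
    onto : ∀ x → x ∉ ⁅ suc e ⁆ → ∃ λ y → e↦f y ≡ x
    onto zero    _  = e , e↦f-e
    onto (suc y) x∉ = y , e↦f-≢ (λ y≡e → x∉ (subst (λ t → suc t ∈ ⁅ suc e ⁆) (sym y≡e) (x∈⁅x⁆ (suc e))))

  f∥e : Indep N ⁅ e ⁆ → Parallel (Indep N′) zero (suc e)
  f∥e e-nonloop = parallel (∉⊥ , subst (Indep N) (sym (∪-identityˡ ⁅ e ⁆)) e-nonloop) e-nonloop
                           (λ (e∉ , _) → e∉ (q⊆p∪q ⊥ ⁅ e ⁆ (x∈⁅x⁆ e)))

another-element : ∀ {k} → 2 ≤ k → (e : Fin k) → ∃ λ c → c ≢ e
another-element {suc (suc _)} _ zero    = suc zero , λ ()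
another-element {suc (suc _)} _ (suc _) = zero , λ ()
another-element {suc zero} (s≤s ()) zero

lemma6p3 : ∀ (k : ℕ) (N : Matroid k) → 2 ≤ k → HasTransitivity N →
    (e : Fin k) → Indep N ⁅ e ⁆ →
    Σ (Fin (suc k)) λ g →
      MinorIso (Indep N) (ParallelIndep N e) ⊥ ⁅ g ⁆ ×
      g ∉ (⁅ suc e ⁆ ∪ ⁅ zero ⁆) ×
      IsCircuit (ParallelIndep N e) (⁅ suc e ⁆ ∪ ⁅ zero ⁆) ×
      (∃ λ g′ → g ≡ suc g′ × (∃ λ h → h ≢ g′ × IsCircuit (Indep N) (⁅ g′ ⁆ ∪ ⁅ h ⁆)))
lemma6p3 k N 2≤k transitive e e-nonloop =
  let open ParallelExtension N e
      c , c≢e = another-element 2≤k e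
      C , D , minor , e∉C , e∉D , f∉C , f∉D =
        transitive (suc k) N′ (suc e) (suc c) zero (c≢e ∘ sym ∘ suc-injective) (λ ()) (λ ())
                   (minor-using-e-c c) (minor-using-c-f c≢e)
      g , g-removed , N′∖g≅N = one-point-extension-minor N N′ rank-N′≤rank-N minor
      g≢e : g ≢ suc e
      g≢e = ∈⊎∈⇒≢ g-removed e∉C e∉D
      g≢f : g ≢ zero
      g≢f = ∈⊎∈⇒≢ g-removed f∉C f∉D
  in g , N′∖g≅N , ≢⇒∉⁅⁆∪⁅⁆ g≢e g≢f , Parallel⇒IsCircuit N′ (Parallel-sym (f∥e e-nonloop)) ,
     deleted-element-in-two-circuit N N′ N′∖f≅N N′∖g≅N g≢f (f∥e e-nonloop) (g≢e ∘ sym)
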